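{- Let $n$ be a positive integer and let $A=L\cup R$ with $L\subseteq[0,n-1]$ and $R\subseteq[n,2n-1]$. For a positive integer $m$, let $R'=R+m\subseteq[n+m,2n+m-1]$, let $M$ be a uniformly random subset of $[n,n+m-1]$, and let $S=L\cup M\cup R'$. Let $a$ be the smallest integer such that $[n,2n-a]\subseteq L+L$ and $[2n+a-2,3n-2]\subseteq R+R$. Let $\tau(L)=|\{i\in L:i\le n-a+1\}|$ and $\tau(R)=|\{i\in R:i\ge n+a-2\}|$. Then for every $\varepsilon>0$ there exists $m_0$ such that for all $m\ge m_0$, $$\mathbb{P}\big([2n-a+1,2n+2m+a-3]\not\subseteq S+S\big)\ \le\ (a-2)\big(2^{ -\tau(R)}+2^{ -\tau(L)}\big)+6\big(2^{ -|L|}+2^{ -|R|}\big)+\varepsilon.$$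
   Context: For integers $a\le b$, $[a,b]=\{x\in\mathbb{Z}:a\le x\le b\}$ (empty if $a>b$). For a set $A$ of integers, $A+A=\{x+y:x,y\in A\}$ and $A+t=\{x+t:x\in A\}$. "Uniformly random subset" means each subset is equally likely.
   Formalization: The number ε ranges only over the positive rationals. -}

module Defs where

open import Data.Bool using (Bool; true; false; T; _∧_; _∨_)
open import Data.Nat using (ℕ; zero; suc; _+_; _*_; _∸_; _^_; _≤_; _<_; _≤ᵇ_; _<ᵇ_; s≤s; z≤n)
open import Data.Nat.Properties
  using (anyUpTo?; allUpTo?; _≤?_; m^n≢0; m+n∸m≡n; m≤m+n; ≤-trans; n≤1+n; m∸n≤m)
open import Data.Vec using (Vec; []; _∷_)
open import Data.List using (List; []; _∷_; _++_; map; length; filter; upTo)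
open import Data.Product using (Σ; ∃; _×_; _,_; proj₁; proj₂)
open import Data.Integer using (ℤ; +_)
open import Data.Rational using (ℚ; _/_)
open import Relation.Nullary using (Dec; yes; no; ¬_)
open import Relation.Nullary.Decidable using (map′; ¬?)
open import Relation.Binary.PropositionalEquality using (_≡_; refl; sym; subst)
open import Data.Unit using (⊤)

NSet : Set
NSet = ℕ → Bool

_∈_ : ℕ → NSet → Set
x ∈ A = T (A x)

_⊆[_,_] : NSet → ℕ → ℕ → Set
A ⊆[ lo , hi ] = ∀ x → x ∈ A → lo ≤ x × x ≤ hi

_∈_⊕_ : ℕ → NSet → NSet → Set
x ∈ A ⊕ B = Σ ℕ λ y → Σ ℕ λ z → y ∈ A × z ∈ B × y + z ≡ x

-- [lo , hi] ⊆ A + A  (vacuous when lo > hi)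
[_,_]⊆_⊕_ : ℕ → ℕ → NSet → NSet → Set
[ lo , hi ]⊆ A ⊕ B = ∀ x → lo ≤ x → x ≤ hi → x ∈ A ⊕ B

-- number of elements of A below b  (= |A| when A ⊆ [0 , b-1])
count : ℕ → NSet → ℕ
count zero    A = 0
count (suc b) A with A b
... | true  = suc (count b A)
... | false = count b A

shift : NSet → ℕ → NSet
shift A t x = (t ≤ᵇ x) ∧ A (x ∸ t)

-- Boolean lookup of a vector at a natural index (false if out of range)
lookupℕ : ∀ {m} → Vec Bool m → ℕ → Bool
lookupℕ []       _       = false
lookupℕ (b ∷ v)  zero    = b
lookupℕ (b ∷ v)  (suc i) = lookupℕ v i

-- A subset of [n , n+m-1] encoded by a vector v of length m:
-- n + i is in the set iff the i-th entry of v is true.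
embed : ∀ {m} → ℕ → Vec Bool m → NSet
embed n v x = (n ≤ᵇ x) ∧ lookupℕ v (x ∸ n)

_∪_ : NSet → NSet → NSet
(A ∪ B) x = A x ∨ B x

allVecs : (m : ℕ) → List (Vec Bool m)
allVecs zero    = [] ∷ []
allVecs (suc m) = map (true ∷_) (allVecs m) ++ map (false ∷_) (allVecs m)

∈? : (A : NSet) (x : ℕ) → Dec (x ∈ A)
∈? A x with A x
... | true  = yes _
... | false = no λ ()

sum? : (A B : NSet) (x : ℕ) → Dec (x ∈ A ⊕ B)
sum? A B x = map′ to from (anyUpTo? P? (suc x))
  where
  P? : ∀ y → Dec (Σ (y ∈ A) λ _ → (x ∸ y) ∈ B)
  P? y with ∈? A y | ∈? B (x ∸ y)
  ... | yes a | yes b = yes (a , b)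
  ... | no ¬a | _     = no λ p → ¬a (proj₁ p)
  ... | _     | no ¬b = no λ p → ¬b (proj₂ p)
  lem : ∀ y → y < suc x → y + (x ∸ y) ≡ x
  lem y (s≤s y≤x) = Data.Nat.Properties.m+[n∸m]≡n y≤x
  to : (∃ λ y → y < suc x × Σ (y ∈ A) λ _ → (x ∸ y) ∈ B) → x ∈ A ⊕ B
  to (y , y<x , a , b) = y , x ∸ y , a , b , lem y y<x
  from : x ∈ A ⊕ B → ∃ λ y → y < suc x × Σ (y ∈ A) λ _ → (x ∸ y) ∈ B
  from (y , z , a , b , refl) = y , s≤s (m≤m+n y z) , a , subst (λ w → w ∈ B) (sym (m+n∸m≡n y z)) b

interval? : (lo hi : ℕ) (A B : NSet) → Dec ([ lo , hi ]⊆ A ⊕ B)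
interval? lo hi A B = map′ to from (allUpTo? Q? (suc hi))
  where
  Q? : ∀ x → Dec (lo ≤ x → x ∈ A ⊕ B)
  Q? x with lo ≤? x | sum? A B x
  ... | _ | yes p = yes λ _ → p
  ... | no ¬l | no _ = yes λ l → Data.Empty.⊥-elim (¬l l)
    where import Data.Empty
  ... | yes l | no ¬p = no λ f → ¬p (f l)
  to : (∀ {x} → x < suc hi → lo ≤ x → x ∈ A ⊕ B) → [ lo , hi ]⊆ A ⊕ B
  to f x l h = f (s≤s h) l
  from : [ lo , hi ]⊆ A ⊕ B → ∀ {x} → x < suc hi → lo ≤ x → x ∈ A ⊕ B
  from g {x} (s≤s h) l = g x l h

half^ : ℕ → ℚ
half^ k = (+ 1) / (2 ^ k)
  where instance _ = m^n≢0 2 k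

prob : (m : ℕ) {E : Vec Bool m → Set} → (∀ v → Dec (E v)) → ℚ
prob m E? = (+ length (filter E? (allVecs m))) / (2 ^ m)
  where instance _ = m^n≢0 2 m

Cond : ℕ → NSet → NSet → ℕ → Set
Cond n L R b = [ n , 2 * n ∸ b ]⊆ L ⊕ L × [ 2 * n + b ∸ 2 , 3 * n ∸ 2 ]⊆ R ⊕ R

-- a is the smallest integer with Cond (integers b ≤ 1, in particular
-- negative ones, never satisfy Cond since 2n-1 ∉ L+L)
IsSmallestA : ℕ → NSet → NSet → ℕ → Set
IsSmallestA n L R a = Cond n L R a × (∀ b → b < a → ¬ Cond n L R b)

Sset : (n m : ℕ) → NSet → NSet → Vec Bool m → NSet
Sset n m L R v = L ∪ (embed n v ∪ shift R m)

τL : ℕ → NSet → ℕ → ℕ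
τL n L a = count n (λ i → L i ∧ (i ≤ᵇ n + 1 ∸ a))

τR : ℕ → NSet → ℕ → ℕ
τR n R a = count (2 * n) (λ i → R i ∧ (n + a ∸ 2 ≤ᵇ i))

module Submission where

-- Corollary B.3.  M ⊆ [n , n + m) is encoded by m fair coins v (coin p is the
-- element n + p), and S = L ∪ M ∪ (R + m).  A point x lies in S + S as soon as
-- two heads p, p' with (n + p) + (n + p') = x occur -- a symmetric pair in some
-- window of coins -- or one head p with l + (n + p) = x for some l ∈ L (or
-- (m + r) + (n + p) = x for some r ∈ R).  If those coins are distinct, the
-- probability that none of them fires is exactly pairFree d / 2ᵈ · 2⁻ᵏ, where
-- d is the window length and k the number of single coins; this is proved in
-- Coins, one coin at a time, from the symmetry of flipping a coin.
-- By the union bound (Sumsets) the failure probability is at most the sum over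
-- the points of the interval, which UnionBound splits into five zones: a - 2
-- points at either end, costing 2^-τ(L) resp. 2^-τ(R) each; two boundary zones
-- costing at most Σⱼ pairFree j / 2ʲ · 2^-|L| ≤ 6 · 2^-|L| (and likewise for R)
-- by Series; and 2n - 1 middle points whose windows are long enough for their
-- total to be at most ε.  Fractions turns these counts into the rational bound,
-- and the theorem follows once a = 2 + a₁ with a₁ ≤ n - 1 and ε = (1+p)/(1+den).

module Coins where

  open import Defs using (NSet; count; lookupℕ; allVecs)
  open import Data.Bool using (Bool; true; false; T; not; _∧_; _∨_; if_then_else_)
  open import Data.Bool.Properties using (∧-assoc; ∧-identityʳ; T-∧; T-≡)
  open import Data.Nat using (ℕ; zero; suc; _+_; _*_; _∸_; _^_; _≤_; _<_; s≤s; z≤n)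
  open import Data.Nat.Properties
  open import Algebra.Properties.CommutativeSemigroup +-commutativeSemigroup using (interchange)
  open import Data.Nat.Tactic.RingSolver using (solve-∀)
  open import Data.Vec using (Vec; []; _∷_)
  open import Data.Sum using (_⊎_; inj₁; inj₂)
  open import Data.Product using (_×_; _,_; proj₁; proj₂)
  open import Data.Empty using (⊥; ⊥-elim)
  open import Function.Bundles using (Equivalence)
  open import Relation.Binary.PropositionalEquality
  open import Relation.Nullary using (yes; no)
  open import Relation.Unary using (Decidable)
  open import Data.List using ([]; _∷_; _++_; map; length; filter)
  open import Data.List.Properties using (length-++; filter-++)

  open Equivalence using (to; from)

  #sat : (m : ℕ) → (Vec Bool m → Bool) → ℕ
  #sat zero    f = if f [] then 1 else 0
  #sat (suc m) f = #sat m (λ v → f (true ∷ v)) + #sat m (λ v → f (false ∷ v))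

  #sat-cong : ∀ m (f g : Vec Bool m → Bool) → (∀ v → f v ≡ g v) → #sat m f ≡ #sat m g
  #sat-cong zero    f g f≡g rewrite f≡g [] = refl
  #sat-cong (suc m) f g f≡g =
    cong₂ _+_ (#sat-cong m _ _ (λ v → f≡g (true ∷ v))) (#sat-cong m _ _ (λ v → f≡g (false ∷ v)))

  #sat-true : ∀ m → #sat m (λ _ → true) ≡ 2 ^ m
  #sat-true zero    = refl
  #sat-true (suc m) rewrite #sat-true m = cong (2 ^ m +_) (sym (+-identityʳ _))

  #sat-false : ∀ m → #sat m (λ _ → false) ≡ 0
  #sat-false zero    = refl
  #sat-false (suc m) rewrite #sat-false m = refl

  #sat-split : ∀ m (f g : Vec Bool m → Bool) →
    #sat m f ≡ #sat m (λ v → g v ∧ f v) + #sat m (λ v → not (g v) ∧ f v)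
  #sat-split zero f g with g [] | f []
  ... | true  | _ = sym (+-identityʳ _)
  ... | false | _ = refl
  #sat-split (suc m) f g =
    trans (cong₂ _+_ (#sat-split m _ (λ v → g (true ∷ v))) (#sat-split m _ (λ v → g (false ∷ v))))
          (interchange (#sat m (λ v → g (true ∷ v) ∧ f (true ∷ v))) (#sat m (λ v → not (g (true ∷ v)) ∧ f (true ∷ v)))
                       (#sat m (λ v → g (false ∷ v) ∧ f (false ∷ v))) (#sat m (λ v → not (g (false ∷ v)) ∧ f (false ∷ v))))

  #sat-mono : ∀ m (f g : Vec Bool m → Bool) → (∀ v → T (f v) → T (g v)) → #sat m f ≤ #sat m g
  #sat-mono zero f g f⇒g with f [] | g [] | f⇒g []
  ... | true  | true  | _  = ≤-refl
  ... | true  | false | im = ⊥-elim (im _)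
  ... | false | _     | _  = z≤n
  #sat-mono (suc m) f g f⇒g =
    +-mono-≤ (#sat-mono m _ _ (λ v → f⇒g (true ∷ v))) (#sat-mono m _ _ (λ v → f⇒g (false ∷ v)))

  #sat-∨ : ∀ m (f g : Vec Bool m → Bool) → #sat m (λ v → f v ∨ g v) ≤ #sat m f + #sat m g
  #sat-∨ zero f g with f [] | g []
  ... | true  | true  = s≤s z≤n
  ... | true  | false = ≤-refl
  ... | false | _     = ≤-refl
  #sat-∨ (suc m) f g = ≤-trans (+-mono-≤ (#sat-∨ m _ _) (#sat-∨ m _ _))
    (≤-reflexive (interchange (#sat m (λ v → f (true ∷ v))) (#sat m (λ v → g (true ∷ v)))
                              (#sat m (λ v → f (false ∷ v))) (#sat m (λ v → g (false ∷ v)))))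

  length-filter-map : ∀ {A B : Set} {E : B → Set} (E? : Decidable E) (g : A → B) xs →
    length (filter E? (map g xs)) ≡ length (filter (λ x → E? (g x)) xs)
  length-filter-map E? g []       = refl
  length-filter-map E? g (x ∷ xs) with E? (g x)
  ... | yes _ = cong suc (length-filter-map E? g xs)
  ... | no  _ = length-filter-map E? g xs

  length-filter-allVecs : ∀ m {E : Vec Bool m → Set} (E? : Decidable E) (f : Vec Bool m → Bool) →
    (∀ v → E v → T (f v)) → length (filter E? (allVecs m)) ≤ #sat m f
  length-filter-allVecs zero E? f E⇒f with E? [] | f [] | E⇒f []
  ... | yes e | true  | _   = ≤-refl
  ... | yes e | false | e⇒f = ⊥-elim (e⇒f e)
  ... | no  _ | _     | _   = z≤n
  length-filter-allVecs (suc m) E? f E⇒f = begin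
    length (filter E? (map (true ∷_) (allVecs m) ++ map (false ∷_) (allVecs m)))
      ≡⟨ cong length (filter-++ E? (map (true ∷_) (allVecs m)) (map (false ∷_) (allVecs m))) ⟩
    length (filter E? (map (true ∷_) (allVecs m)) ++ filter E? (map (false ∷_) (allVecs m)))
      ≡⟨ length-++ (filter E? (map (true ∷_) (allVecs m))) ⟩
    length (filter E? (map (true ∷_) (allVecs m))) + length (filter E? (map (false ∷_) (allVecs m)))
      ≡⟨ cong₂ _+_ (length-filter-map E? (true ∷_) (allVecs m)) (length-filter-map E? (false ∷_) (allVecs m)) ⟩
    length (filter (λ v → E? (true ∷ v)) (allVecs m)) + length (filter (λ v → E? (false ∷ v)) (allVecs m))
      ≤⟨ +-mono-≤ (length-filter-allVecs m (λ v → E? (true ∷ v)) _ (λ v → E⇒f (true ∷ v)))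
                  (length-filter-allVecs m (λ v → E? (false ∷ v)) _ (λ v → E⇒f (false ∷ v))) ⟩
    #sat (suc m) f ∎
    where open ≤-Reasoning

  -- flip q v turns coin q over (and does nothing if q ≥ m)
  flip : ∀ {m} → ℕ → Vec Bool m → Vec Bool m
  flip q       []      = []
  flip zero    (b ∷ v) = not b ∷ v
  flip (suc q) (b ∷ v) = b ∷ flip q v

  -- flipping a coin is a bijection of {0,1}ᵐ, so it preserves counts
  #sat-flip : ∀ m q (f : Vec Bool m → Bool) → #sat m (λ v → f (flip q v)) ≡ #sat m f
  #sat-flip zero    q       f = refl
  #sat-flip (suc m) zero    f = +-comm (#sat m (λ v → f (false ∷ v))) (#sat m (λ v → f (true ∷ v)))
  #sat-flip (suc m) (suc q) f =
    cong₂ _+_ (#sat-flip m q (λ v → f (true ∷ v))) (#sat-flip m q (λ v → f (false ∷ v)))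

  lookup-flip-same : ∀ {m} q (v : Vec Bool m) → q < m → lookupℕ (flip q v) q ≡ not (lookupℕ v q)
  lookup-flip-same zero    (b ∷ v) _       = refl
  lookup-flip-same (suc q) (b ∷ v) (s≤s q<m) = lookup-flip-same q v q<m

  lookup-flip-other : ∀ {m} p q (v : Vec Bool m) → p ≢ q → lookupℕ (flip q v) p ≡ lookupℕ v p
  lookup-flip-other p       q       []      p≢q = refl
  lookup-flip-other zero    zero    (b ∷ v) p≢q = ⊥-elim (p≢q refl)
  lookup-flip-other zero    (suc q) (b ∷ v) p≢q = refl
  lookup-flip-other (suc p) zero    (b ∷ v) p≢q = refl
  lookup-flip-other (suc p) (suc q) (b ∷ v) p≢q = lookup-flip-other p q v (λ p≡q → p≢q (cong suc p≡q))

  Ignores : ∀ {m} → ℕ → (Vec Bool m → Bool) → Set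
  Ignores q f = ∀ v → f (flip q v) ≡ f v

  heads≡tails : ∀ m q (f : Vec Bool m → Bool) → q < m → Ignores q f →
    #sat m (λ v → lookupℕ v q ∧ f v) ≡ #sat m (λ v → not (lookupℕ v q) ∧ f v)
  heads≡tails m q f q<m ign = trans (sym (#sat-flip m q (λ v → lookupℕ v q ∧ f v)))
    (#sat-cong m _ _ (λ v → cong₂ _∧_ (lookup-flip-same q v q<m) (ign v)))

  tails-half : ∀ m q (f : Vec Bool m → Bool) → q < m → Ignores q f →
    #sat m (λ v → not (lookupℕ v q) ∧ f v) * 2 ≡ #sat m f
  tails-half m q f q<m ign = begin
    tails * 2       ≡⟨ *-comm tails 2 ⟩
    tails + (tails + 0) ≡⟨ cong (tails +_) (+-identityʳ tails) ⟩
    tails + tails   ≡⟨ cong (_+ tails) (heads≡tails m q f q<m ign) ⟨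
    #sat m (λ v → lookupℕ v q ∧ f v) + tails ≡⟨ #sat-split m f (λ v → lookupℕ v q) ⟨
    #sat m f        ∎
    where
    open ≡-Reasoning
    tails : ℕ
    tails = #sat m (λ v → not (lookupℕ v q) ∧ f v)

  heads-half : ∀ m q (f : Vec Bool m → Bool) → q < m → Ignores q f →
    #sat m (λ v → lookupℕ v q ∧ f v) * 2 ≡ #sat m f
  heads-half m q f q<m ign = trans (cong (_* 2) (heads≡tails m q f q<m ign)) (tails-half m q f q<m ign)

  notBothHeads : ∀ m p q (f : Vec Bool m → Bool) → p ≢ q → p < m → q < m → Ignores p f → Ignores q f →
    #sat m (λ v → not (lookupℕ v p ∧ lookupℕ v q) ∧ f v) * 4 ≡ 3 * #sat m f
  notBothHeads m p q f p≢q p<m q<m ign-p ign-q = +-cancelʳ-≡ C (notBoth * 4) (3 * C) (begin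
    notBoth * 4 + C          ≡⟨ cong (notBoth * 4 +_) both-quarter ⟨
    notBoth * 4 + both * 4   ≡⟨ *-distribʳ-+ 4 notBoth both ⟨
    (notBoth + both) * 4     ≡⟨ cong (_* 4) (trans (+-comm notBoth both) (sym split)) ⟩
    C * 4                    ≡⟨ four-times C ⟩
    3 * C + C                ∎)
    where
    open ≡-Reasoning
    four-times : ∀ x → x * 4 ≡ 3 * x + x
    four-times = solve-∀
    C : ℕ
    C = #sat m f
    both : ℕ
    both = #sat m (λ v → (lookupℕ v p ∧ lookupℕ v q) ∧ f v)
    notBoth : ℕ
    notBoth = #sat m (λ v → not (lookupℕ v p ∧ lookupℕ v q) ∧ f v)
    split : C ≡ both + notBoth
    split = #sat-split m f (λ v → lookupℕ v p ∧ lookupℕ v q)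
    q-and-f : Vec Bool m → Bool
    q-and-f v = lookupℕ v q ∧ f v
    both-quarter : both * 4 ≡ C
    both-quarter = begin
      both * 4                                    ≡⟨ cong (_* 4) (#sat-cong m _ _ (λ v → ∧-assoc (lookupℕ v p) _ (f v))) ⟩
      #sat m (λ v → lookupℕ v p ∧ q-and-f v) * (2 * 2) ≡⟨ *-assoc (#sat m (λ v → lookupℕ v p ∧ q-and-f v)) 2 2 ⟨
      #sat m (λ v → lookupℕ v p ∧ q-and-f v) * 2 * 2   ≡⟨ cong (_* 2) (heads-half m p q-and-f p<m
                                                            (λ v → cong₂ _∧_ (lookup-flip-other q p v (λ q≡p → p≢q (sym q≡p))) (ign-p v))) ⟩
      #sat m q-and-f * 2                          ≡⟨ heads-half m q f q<m ign-q ⟩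
      C                                           ∎

  Outside : ℕ → ℕ → ℕ → Set
  Outside lo d q = q < lo ⊎ lo + d ≤ q

  inside≢outside : ∀ {lo d p q} → lo ≤ p → p < lo + d → Outside lo d q → p ≢ q
  inside≢outside lo≤p p<hi (inj₁ q<lo) refl = <⇒≱ q<lo lo≤p
  inside≢outside lo≤p p<hi (inj₂ hi≤q) refl = <⇒≱ p<hi hi≤q

  -- noPair lo d v : no two heads at symmetric positions lo + i and lo + d - 1 - i
  -- of the window [lo , lo + d), i.e. no two heads (possibly the same coin used
  -- twice) whose positions add up to lo + lo + d - 1
  noPair : ∀ {m} → ℕ → ℕ → Vec Bool m → Bool
  noPair lo zero          v = true
  noPair lo (suc zero)    v = not (lookupℕ v lo)
  noPair lo (suc (suc d)) v = not (lookupℕ v lo ∧ lookupℕ v (lo + suc d)) ∧ noPair (suc lo) d v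

  -- the number of patterns on a window of length d satisfying noPair, 3^⌊d/2⌋
  pairFree : ℕ → ℕ
  pairFree zero          = 1
  pairFree (suc zero)    = 1
  pairFree (suc (suc d)) = 3 * pairFree d

  module Window (lo d : ℕ) where
    hi : ℕ
    hi = lo + suc d

    end≡ : lo + suc (suc d) ≡ suc hi
    end≡ = +-suc lo (suc d)

    lo<hi : lo < hi
    lo<hi = m<m+n lo (s≤s z≤n)

    hi≡inner-end : suc lo + d ≡ hi
    hi≡inner-end = sym (+-suc lo d)

    lo-outside : Outside (suc lo) d lo
    lo-outside = inj₁ ≤-refl

    hi-outside : Outside (suc lo) d hi
    hi-outside = inj₂ (≤-reflexive hi≡inner-end)

    inner-lower : ∀ {q} → suc lo ≤ q → lo ≤ q
    inner-lower le = ≤-trans (n≤1+n lo) le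

    inner-upper : ∀ {q} → q < suc lo + d → q < lo + suc (suc d)
    inner-upper lt = ≤-trans lt (≤-trans (≤-reflexive hi≡inner-end) (≤-trans (n≤1+n hi) (≤-reflexive (sym end≡))))

    hi-upper : hi < lo + suc (suc d)
    hi-upper = ≤-reflexive (sym end≡)

    outside-inner : ∀ {q} → Outside lo (suc (suc d)) q → Outside (suc lo) d q
    outside-inner (inj₁ q<lo) = inj₁ (≤-trans q<lo (n≤1+n lo))
    outside-inner {q} (inj₂ le) = inj₂ (≤-trans (≤-reflexive hi≡inner-end) (≤-trans (n≤1+n hi) (subst (_≤ q) end≡ le)))

  noPair-ignores : ∀ {m} lo d q → Outside lo d q → Ignores {m} q (noPair lo d)
  noPair-ignores lo zero          q out v = refl
  noPair-ignores lo (suc zero)    q out v =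
    cong not (lookup-flip-other lo q v (inside≢outside ≤-refl (m<m+n lo (s≤s z≤n)) out))
  noPair-ignores lo (suc (suc d)) q out v =
    cong₂ _∧_ (cong₂ (λ x y → not (x ∧ y))
                     (lookup-flip-other lo q v (inside≢outside ≤-refl (<-trans lo<hi hi-upper) out))
                     (lookup-flip-other hi q v (inside≢outside (<⇒≤ lo<hi) hi-upper out)))
              (noPair-ignores (suc lo) d q (outside-inner out) v)
    where open Window lo d

  noPair-count : ∀ m lo d (f : Vec Bool m → Bool) → lo + d ≤ m →
    (∀ q → lo ≤ q → q < lo + d → Ignores q f) →
    #sat m (λ v → noPair lo d v ∧ f v) * 2 ^ d ≡ pairFree d * #sat m f
  noPair-count m lo zero f _ _ = trans (*-identityʳ _) (sym (+-identityʳ _))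
  noPair-count m lo (suc zero) f lo<m ign =
    trans (tails-half m lo f (subst (_≤ m) (+-comm lo 1) lo<m) (ign lo ≤-refl (m<m+n lo (s≤s z≤n))))
          (sym (+-identityʳ _))
  noPair-count m lo (suc (suc d)) f end≤m ign = begin
    #sat m (λ v → noPair lo (suc (suc d)) v ∧ f v) * (2 * (2 * 2 ^ d))
      ≡⟨ cong₂ _*_ (#sat-cong m _ _ (λ v → ∧-assoc (not (lookupℕ v lo ∧ lookupℕ v hi)) _ (f v))) (four-pow (2 ^ d)) ⟩
    pairs * (4 * 2 ^ d)      ≡⟨ *-assoc pairs 4 (2 ^ d) ⟨
    pairs * 4 * 2 ^ d
      ≡⟨ cong (_* 2 ^ d) (notBothHeads m lo hi g (<⇒≢ lo<hi) (<-trans lo<hi hi<m) hi<m ign-lo ign-hi) ⟩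
    3 * #sat m g * 2 ^ d  ≡⟨ *-assoc 3 (#sat m g) (2 ^ d) ⟩
    3 * (#sat m g * 2 ^ d)  ≡⟨ cong (3 *_) inner ⟩
    3 * (pairFree d * #sat m f)  ≡⟨ *-assoc 3 (pairFree d) (#sat m f) ⟨
    3 * pairFree d * #sat m f ∎
    where
    open ≡-Reasoning
    open Window lo d
    four-pow : ∀ y → 2 * (2 * y) ≡ 4 * y
    four-pow = solve-∀
    g : Vec Bool m → Bool
    g v = noPair (suc lo) d v ∧ f v
    pairs : ℕ
    pairs = #sat m (λ v → not (lookupℕ v lo ∧ lookupℕ v hi) ∧ g v)
    hi<m : hi < m
    hi<m = subst (_≤ m) end≡ end≤m
    ign-lo : Ignores lo g
    ign-lo v = cong₂ _∧_ (noPair-ignores (suc lo) d lo lo-outside v) (ign lo ≤-refl (<-trans lo<hi hi-upper) v)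
    ign-hi : Ignores hi g
    ign-hi v = cong₂ _∧_ (noPair-ignores (suc lo) d hi hi-outside v) (ign hi (<⇒≤ lo<hi) hi-upper v)
    inner : #sat m g * 2 ^ d ≡ pairFree d * #sat m f
    inner = noPair-count m (suc lo) d f (≤-trans (≤-reflexive hi≡inner-end) (<⇒≤ hi<m))
              (λ q lo<q q<end → ign q (inner-lower lo<q) (inner-upper q<end))

  avoid : ∀ {m} → ℕ → ℕ → NSet → Vec Bool m → Bool
  avoid B zero    A v = true
  avoid B (suc k) A v = not (A k ∧ lookupℕ v (B ∸ k)) ∧ avoid B k A v

  avoid-ignores : ∀ {m} B k A q → (∀ l → l < k → T (A l) → B ∸ l ≢ q) → Ignores {m} q (avoid B k A)
  avoid-ignores B zero    A q apart v = refl
  avoid-ignores B (suc k) A q apart v with A k in Ak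
  ... | true  = cong₂ _∧_ (cong not (lookup-flip-other (B ∸ k) q v (apart k ≤-refl (from T-≡ Ak))))
                          (avoid-ignores B k A q (λ l l<k → apart l (m<n⇒m<1+n l<k)) v)
  ... | false = avoid-ignores B k A q (λ l l<k → apart l (m<n⇒m<1+n l<k)) v

  avoid-count : ∀ m B k A (f : Vec Bool m → Bool) →
    (∀ l → l < k → T (A l) → l ≤ B × B ∸ l < m × Ignores (B ∸ l) f) →
    #sat m (λ v → avoid B k A v ∧ f v) * 2 ^ count k A ≡ #sat m f
  avoid-count m B zero    A f coins = *-identityʳ _
  avoid-count m B (suc k) A f coins with A k in Ak
  ... | true  = begin
    #sat m (λ v → (not (lookupℕ v (B ∸ k)) ∧ avoid B k A v) ∧ f v) * (2 * 2 ^ count k A)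
      ≡⟨ cong₂ _*_ (#sat-cong m _ _ (λ v → ∧-assoc (not (lookupℕ v (B ∸ k))) _ (f v))) refl ⟩
    #sat m (λ v → not (lookupℕ v (B ∸ k)) ∧ g v) * (2 * 2 ^ count k A)
      ≡⟨ *-assoc (#sat m (λ v → not (lookupℕ v (B ∸ k)) ∧ g v)) 2 (2 ^ count k A) ⟨
    #sat m (λ v → not (lookupℕ v (B ∸ k)) ∧ g v) * 2 * 2 ^ count k A
      ≡⟨ cong (_* 2 ^ count k A) (tails-half m (B ∸ k) g B∸k<m ign-g) ⟩
    #sat m g * 2 ^ count k A  ≡⟨ avoid-count m B k A f (λ l l<k → coins l (m<n⇒m<1+n l<k)) ⟩
    #sat m f ∎
    where
    open ≡-Reasoning
    g : Vec Bool m → Bool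
    g v = avoid B k A v ∧ f v
    coin-k : k ≤ B × B ∸ k < m × Ignores (B ∸ k) f
    coin-k = coins k ≤-refl (from T-≡ Ak)
    B∸k<m : B ∸ k < m
    B∸k<m = proj₁ (proj₂ coin-k)
    ign-g : Ignores (B ∸ k) g
    ign-g v = cong₂ _∧_ (avoid-ignores B k A (B ∸ k) (λ l l<k _ → >⇒≢ (∸-monoʳ-< l<k (proj₁ coin-k))) v)
                        (proj₂ (proj₂ coin-k) v)
  ... | false = avoid-count m B k A f (λ l l<k → coins l (m<n⇒m<1+n l<k))

  joint-count : ∀ m lo d B k A → lo + d ≤ m →
    (∀ l → l < k → T (A l) → l ≤ B × B ∸ l < m × Outside lo d (B ∸ l)) →
    #sat m (λ v → noPair lo d v ∧ avoid B k A v) * 2 ^ d * 2 ^ count k A ≡ pairFree d * 2 ^ m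
  joint-count m lo d B k A end≤m coins = begin
    #sat m (λ v → noPair lo d v ∧ avoid B k A v) * 2 ^ d * 2 ^ count k A
      ≡⟨ cong (_* 2 ^ count k A) (noPair-count m lo d (avoid B k A) end≤m avoid-ignores-window) ⟩
    pairFree d * #sat m (avoid B k A) * 2 ^ count k A
      ≡⟨ *-assoc (pairFree d) _ _ ⟩
    pairFree d * (#sat m (avoid B k A) * 2 ^ count k A)
      ≡⟨ cong (λ z → pairFree d * (z * 2 ^ count k A)) (#sat-cong m _ _ (λ v → sym (∧-identityʳ _))) ⟩
    pairFree d * (#sat m (λ v → avoid B k A v ∧ true) * 2 ^ count k A)
      ≡⟨ cong (pairFree d *_) (avoid-count m B k A (λ _ → true) (λ l l<k Al →
           proj₁ (coins l l<k Al) , proj₁ (proj₂ (coins l l<k Al)) , λ _ → refl)) ⟩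
    pairFree d * #sat m (λ _ → true)  ≡⟨ cong (pairFree d *_) (#sat-true m) ⟩
    pairFree d * 2 ^ m ∎
    where
    open ≡-Reasoning
    avoid-ignores-window : ∀ q → lo ≤ q → q < lo + d → Ignores q (avoid B k A)
    avoid-ignores-window q lo≤q q<end = avoid-ignores B k A q (λ l l<k Al B∸l≡q →
      inside≢outside lo≤q q<end (proj₂ (proj₂ (coins l l<k Al))) (sym B∸l≡q))

  ¬T⇒T-not : ∀ {b} → (T b → ⊥) → T (not b)
  ¬T⇒T-not {false} _    = _
  ¬T⇒T-not {true}  ¬tt = ¬tt _

  noPair-holds : ∀ {m} lo d (v : Vec Bool m) →
    (∀ p p' → T (lookupℕ v p) → T (lookupℕ v p') → suc (p + p') ≡ lo + lo + d → ⊥) → T (noPair lo d v)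
  noPair-holds lo zero          v none = _
  noPair-holds lo (suc zero)    v none = ¬T⇒T-not (λ h → none lo lo h h (+-comm 1 (lo + lo)))
  noPair-holds lo (suc (suc d)) v none = from T-∧
    ( ¬T⇒T-not (λ h → none lo (lo + suc d) (proj₁ (to T-∧ h)) (proj₂ (to T-∧ h)) (ends lo d))
    , noPair-holds (suc lo) d v (λ p p' hp hp' sum → none p p' hp hp' (trans sum (inner lo d))))
    where
    ends : ∀ lo d → suc (lo + (lo + suc d)) ≡ lo + lo + suc (suc d)
    ends = solve-∀
    inner : ∀ lo d → suc lo + suc lo + d ≡ lo + lo + suc (suc d)
    inner = solve-∀

  avoid-holds : ∀ {m} B k A (v : Vec Bool m) →
    (∀ l → l < k → T (A l) → T (lookupℕ v (B ∸ l)) → ⊥) → T (avoid B k A v)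
  avoid-holds B zero    A v none = _
  avoid-holds B (suc k) A v none = from T-∧
    ( ¬T⇒T-not (λ h → none k ≤-refl (proj₁ (to T-∧ h)) (proj₂ (to T-∧ h)))
    , avoid-holds B k A v (λ l l<k → none l (m<n⇒m<1+n l<k)))

  destroyed-event-bound : ∀ m lo d B k A (event : Vec Bool m → Bool) → lo + d ≤ m →
    (∀ l → l < k → T (A l) → l ≤ B × B ∸ l < m × Outside lo d (B ∸ l)) →
    (∀ v → T (event v) → ∀ p p' → T (lookupℕ v p) → T (lookupℕ v p') → suc (p + p') ≡ lo + lo + d → ⊥) →
    (∀ v → T (event v) → ∀ l → l < k → T (A l) → T (lookupℕ v (B ∸ l)) → ⊥) →
    #sat m event * 2 ^ d * 2 ^ count k A ≤ pairFree d * 2 ^ m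
  destroyed-event-bound m lo d B k A event end≤m coins by-pair by-coin = ≤-trans
    (*-monoˡ-≤ (2 ^ count k A) (*-monoˡ-≤ (2 ^ d) (#sat-mono m event _
       (λ v ev → from T-∧ (noPair-holds lo d v (by-pair v ev) , avoid-holds B k A v (by-coin v ev))))))
    (≤-reflexive (joint-count m lo d B k A end≤m coins))

module Series where

  open Coins using (pairFree)
  open import Data.Nat using (ℕ; zero; suc; _+_; _*_; _∸_; _^_; _≤_; _<_; s≤s; z≤n; s≤s⁻¹)
  open import Data.Nat.Properties
  open import Data.Nat.Tactic.RingSolver using (solve-∀)
  open import Relation.Binary.PropositionalEquality

  sumBelow : ℕ → (ℕ → ℕ) → ℕ
  sumBelow zero    y = 0
  sumBelow (suc N) y = sumBelow N y + y N

  sumBelow-++ : ∀ a b y → sumBelow (a + b) y ≡ sumBelow a y + sumBelow b (λ j → y (a + j))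
  sumBelow-++ a zero    y rewrite +-identityʳ a = sym (+-identityʳ _)
  sumBelow-++ a (suc b) y rewrite +-suc a b | sumBelow-++ a b y = +-assoc (sumBelow a y) _ _

  sumBelow-head : ∀ N y → sumBelow (suc N) y ≡ y 0 + sumBelow N (λ j → y (suc j))
  sumBelow-head zero    y = sym (+-identityʳ (y 0))
  sumBelow-head (suc N) y rewrite sumBelow-head N y = +-assoc (y 0) _ _

  sumBelow-reverse : ∀ N y → sumBelow N y ≡ sumBelow N (λ j → y (N ∸ suc j))
  sumBelow-reverse zero    y = refl
  sumBelow-reverse (suc N) y = begin
    sumBelow N y + y N                          ≡⟨ cong (_+ y N) (sumBelow-reverse N y) ⟩
    sumBelow N (λ j → y (N ∸ suc j)) + y N      ≡⟨ +-comm (sumBelow N (λ j → y (N ∸ suc j))) (y N) ⟩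
    y N + sumBelow N (λ j → y (N ∸ suc j))      ≡⟨ sumBelow-head N (λ j → y (suc N ∸ suc j)) ⟨
    sumBelow (suc N) (λ j → y (suc N ∸ suc j))  ∎
    where open ≡-Reasoning

  sumBelow-bound : ∀ N y E F → (∀ j → j < N → y j * E ≤ F) → sumBelow N y * E ≤ N * F
  sumBelow-bound zero    y E F h = z≤n
  sumBelow-bound (suc N) y E F h = begin
    (sumBelow N y + y N) * E        ≡⟨ *-distribʳ-+ E (sumBelow N y) (y N) ⟩
    sumBelow N y * E + y N * E      ≤⟨ +-mono-≤ (sumBelow-bound N y E F (λ j j<N → h j (m<n⇒m<1+n j<N))) (h N ≤-refl) ⟩
    N * F + F                       ≡⟨ +-comm (N * F) F ⟩
    suc N * F                       ∎
    where open ≤-Reasoning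

  -- The series Σ_j pairFree j / 2ʲ converges to 6. Scaled by 2ᴺ, its partial
  -- sums are scaledPartial N, and slack N = 6·2ᴺ - scaledPartial N satisfies a
  -- recursion of its own; the two add up to 6·2ᴺ exactly.
  scaledPartial : ℕ → ℕ
  scaledPartial zero    = 0
  scaledPartial (suc N) = 2 * scaledPartial N + 2 * pairFree N

  slack : ℕ → ℕ
  slack zero          = 6
  slack (suc zero)    = 10
  slack (suc (suc N)) = 3 * slack N

  slack-step : ∀ N → 2 * pairFree N + slack (suc N) ≡ 2 * slack N
  slack-step zero          = refl
  slack-step (suc zero)    = refl
  slack-step (suc (suc N)) = begin
    2 * (3 * pairFree N) + 3 * slack (suc N) ≡⟨ factor-3 (pairFree N) (slack (suc N)) ⟩
    3 * (2 * pairFree N + slack (suc N))     ≡⟨ cong (3 *_) (slack-step N) ⟩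
    3 * (2 * slack N)                        ≡⟨ swap (slack N) ⟩
    2 * (3 * slack N)                        ∎
    where
    open ≡-Reasoning
    factor-3 : ∀ c s → 2 * (3 * c) + 3 * s ≡ 3 * (2 * c + s)
    factor-3 = solve-∀
    swap : ∀ s → 3 * (2 * s) ≡ 2 * (3 * s)
    swap = solve-∀

  partial+slack : ∀ N → scaledPartial N + slack N ≡ 6 * 2 ^ N
  partial+slack zero    = refl
  partial+slack (suc N) = begin
    2 * scaledPartial N + 2 * pairFree N + slack (suc N)   ≡⟨ +-assoc (2 * scaledPartial N) _ _ ⟩
    2 * scaledPartial N + (2 * pairFree N + slack (suc N)) ≡⟨ cong (2 * scaledPartial N +_) (slack-step N) ⟩
    2 * scaledPartial N + 2 * slack N                      ≡⟨ *-distribˡ-+ 2 (scaledPartial N) (slack N) ⟨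
    2 * (scaledPartial N + slack N)                        ≡⟨ cong (2 *_) (partial+slack N) ⟩
    2 * (6 * 2 ^ N)                                        ≡⟨ swap (2 ^ N) ⟩
    6 * (2 * 2 ^ N)                                        ∎
    where
    open ≡-Reasoning
    swap : ∀ x → 2 * (6 * x) ≡ 6 * (2 * x)
    swap = solve-∀

  pairFree-series : ∀ N y e m → (∀ j → j < N → y j * 2 ^ j * 2 ^ e ≤ pairFree j * 2 ^ m) →
    sumBelow N y * 2 ^ e ≤ 6 * 2 ^ m
  pairFree-series N y e m h = *-cancelʳ-≤ (sumBelow N y * 2 ^ e) (6 * 2 ^ m) (2 ^ N) {{m^n≢0 2 N}} (begin
    sumBelow N y * 2 ^ e * 2 ^ N   ≤⟨ scaled N h ⟩
    scaledPartial N * 2 ^ m        ≤⟨ *-monoˡ-≤ (2 ^ m) (≤-trans (m≤m+n (scaledPartial N) (slack N)) (≤-reflexive (partial+slack N))) ⟩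
    6 * 2 ^ N * 2 ^ m              ≡⟨ swap (2 ^ N) (2 ^ m) ⟩
    6 * 2 ^ m * 2 ^ N              ∎)
    where
    open ≤-Reasoning
    swap : ∀ P M → 6 * P * M ≡ 6 * M * P
    swap = solve-∀
    scaled : ∀ K → (∀ j → j < K → y j * 2 ^ j * 2 ^ e ≤ pairFree j * 2 ^ m) →
      sumBelow K y * 2 ^ e * 2 ^ K ≤ scaledPartial K * 2 ^ m
    scaled zero    hK = z≤n
    scaled (suc K) hK = begin
      (sumBelow K y + y K) * 2 ^ e * (2 * 2 ^ K)
        ≡⟨ regroup (sumBelow K y) (y K) (2 ^ e) (2 ^ K) ⟩
      2 * (sumBelow K y * 2 ^ e * 2 ^ K) + 2 * (y K * 2 ^ K * 2 ^ e)
        ≤⟨ +-mono-≤ (*-monoʳ-≤ 2 (scaled K (λ j j<K → hK j (m<n⇒m<1+n j<K)))) (*-monoʳ-≤ 2 (hK K ≤-refl)) ⟩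
      2 * (scaledPartial K * 2 ^ m) + 2 * (pairFree K * 2 ^ m)
        ≡⟨ collect (scaledPartial K) (pairFree K) (2 ^ m) ⟩
      (2 * scaledPartial K + 2 * pairFree K) * 2 ^ m ∎
      where
      regroup : ∀ s t E P → (s + t) * E * (2 * P) ≡ 2 * (s * E * P) + 2 * (t * P * E)
      regroup = solve-∀
      collect : ∀ s c M → 2 * (s * M) + 2 * (c * M) ≡ (2 * s + 2 * c) * M
      collect = solve-∀

  pairFree≤2^ : ∀ d → pairFree d ≤ 2 ^ d
  pairFree≤2^ zero          = ≤-refl
  pairFree≤2^ (suc zero)    = s≤s z≤n
  pairFree≤2^ (suc (suc d)) = begin
    3 * pairFree d  ≤⟨ *-monoʳ-≤ 3 (pairFree≤2^ d) ⟩
    3 * 2 ^ d       ≤⟨ *-monoˡ-≤ (2 ^ d) {3} {4} (s≤s (s≤s (s≤s z≤n))) ⟩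
    4 * 2 ^ d       ≡⟨ four (2 ^ d) ⟩
    2 * (2 * 2 ^ d) ∎
    where
    open ≤-Reasoning
    four : ∀ x → 4 * x ≡ 2 * (2 * x)
    four = solve-∀

  pairFree-decay : ∀ t d → 2 * t ≤ d → pairFree d * 4 ^ t ≤ 3 ^ t * 2 ^ d
  pairFree-decay zero    d _ = ≤-trans (≤-reflexive (*-identityʳ (pairFree d)))
                                       (≤-trans (pairFree≤2^ d) (≤-reflexive (sym (+-identityʳ _))))
  pairFree-decay (suc t) (suc zero) (s≤s le) with subst (_≤ 0) (+-suc t (t + 0)) le
  ... | ()
  pairFree-decay (suc t) (suc (suc d)) (s≤s le) = begin
    3 * pairFree d * (4 * 4 ^ t)       ≡⟨ regroup (pairFree d) (4 ^ t) ⟩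
    12 * (pairFree d * 4 ^ t)          ≤⟨ *-monoʳ-≤ 12 (pairFree-decay t d (s≤s⁻¹ (subst (_≤ suc d) (+-suc t (t + 0)) le))) ⟩
    12 * (3 ^ t * 2 ^ d)               ≡⟨ spread (3 ^ t) (2 ^ d) ⟩
    3 * 3 ^ t * (2 * (2 * 2 ^ d))      ∎
    where
    open ≤-Reasoning
    regroup : ∀ c F → 3 * c * (4 * F) ≡ 12 * (c * F)
    regroup = solve-∀
    spread : ∀ T D → 12 * (T * D) ≡ 3 * T * (2 * (2 * D))
    spread = solve-∀

  linear≤exp : ∀ t → 3 ^ t * (3 + t) ≤ 3 * 4 ^ t
  linear≤exp zero    = ≤-refl
  linear≤exp (suc t) = begin
    3 * 3 ^ t * (3 + suc t)   ≤⟨ ≤-trans (m≤m+n _ (3 ^ t * t)) (≤-reflexive (expand (3 ^ t) t)) ⟩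
    4 * (3 ^ t * (3 + t))     ≤⟨ *-monoʳ-≤ 4 (linear≤exp t) ⟩
    4 * (3 * 4 ^ t)           ≡⟨ swap (4 ^ t) ⟩
    3 * (4 * 4 ^ t)           ∎
    where
    open ≤-Reasoning
    expand : ∀ P t → 3 * P * (3 + suc t) + P * t ≡ 4 * (P * (3 + t))
    expand = solve-∀
    swap : ∀ x → 4 * (3 * x) ≡ 3 * (4 * x)
    swap = solve-∀

  decay-by-K : ∀ K → 3 ^ (3 * K) * K ≤ 4 ^ (3 * K)
  decay-by-K K = ≤-trans (*-monoʳ-≤ (3 ^ (3 * K)) (n≤1+n K)) (*-cancelˡ-≤ 3 (begin
    3 * (3 ^ (3 * K) * suc K)   ≡⟨ distribute (3 ^ (3 * K)) K ⟩
    3 ^ (3 * K) * (3 + 3 * K)   ≤⟨ linear≤exp (3 * K) ⟩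
    3 * 4 ^ (3 * K)             ∎))
    where
    open ≤-Reasoning
    distribute : ∀ P K → 3 * (P * suc K) ≡ P * (3 + 3 * K)
    distribute = solve-∀

  pairFree-small : ∀ Y M t d → 2 * t ≤ d → Y * 2 ^ d ≤ pairFree d * M → Y * 4 ^ t ≤ 3 ^ t * M
  pairFree-small Y M t d 2t≤d h = *-cancelʳ-≤ (Y * 4 ^ t) (3 ^ t * M) (2 ^ d) {{m^n≢0 2 d}} (begin
    Y * 4 ^ t * 2 ^ d            ≡⟨ swap Y (4 ^ t) (2 ^ d) ⟩
    Y * 2 ^ d * 4 ^ t            ≤⟨ *-monoˡ-≤ (4 ^ t) h ⟩
    pairFree d * M * 4 ^ t       ≡⟨ swap (pairFree d) M (4 ^ t) ⟩
    pairFree d * 4 ^ t * M       ≤⟨ *-monoˡ-≤ M (pairFree-decay t d 2t≤d) ⟩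
    3 ^ t * 2 ^ d * M            ≡⟨ swap (3 ^ t) (2 ^ d) M ⟩
    3 ^ t * M * 2 ^ d            ∎)
    where
    open ≤-Reasoning
    swap : ∀ a b c → a * b * c ≡ a * c * b
    swap = solve-∀

  decaying-series : ∀ N q M y → (∀ j → j < N → y j * 4 ^ (3 * (N * q)) ≤ 3 ^ (3 * (N * q)) * M) →
    sumBelow N y * q ≤ M
  decaying-series N q M y h = *-cancelʳ-≤ (sumBelow N y * q) M (4 ^ t) {{m^n≢0 4 t}} (begin
    sumBelow N y * q * 4 ^ t        ≡⟨ swap (sumBelow N y) q (4 ^ t) ⟩
    sumBelow N y * 4 ^ t * q        ≤⟨ *-monoˡ-≤ q (sumBelow-bound N y (4 ^ t) (3 ^ t * M) h) ⟩
    N * (3 ^ t * M) * q             ≡⟨ regroup N (3 ^ t) M q ⟩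
    3 ^ t * (N * q) * M             ≤⟨ *-monoˡ-≤ M (decay-by-K (N * q)) ⟩
    4 ^ t * M                       ≡⟨ *-comm (4 ^ t) M ⟩
    M * 4 ^ t                       ∎)
    where
    open ≤-Reasoning
    t : ℕ
    t = 3 * (N * q)
    swap : ∀ a b c → a * b * c ≡ a * c * b
    swap = solve-∀
    regroup : ∀ N P M q → N * (P * M) * q ≡ P * (N * q) * M
    regroup = solve-∀

module Fractions where

  open import Defs using (half^)
  open import Data.Nat as ℕ using (ℕ; zero; suc; NonZero; _^_)
  import Data.Nat.Properties as ℕ
  open import Data.Nat.Tactic.RingSolver using (solve-∀)
  open import Data.Integer as ℤ using (+_; -[1+_])
  import Data.Integer.Properties as ℤ
  open import Data.Rational using (ℚ; mkℚ; 0ℚ; _/_; _+_; _*_; _≤_; _<_; *<*; toℚᵘ)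
  open import Data.Rational.Properties using (toℚᵘ-fromℚᵘ; toℚᵘ-cancel-≤; toℚᵘ-injective; toℚᵘ-homo-*;
    toℚᵘ-homo-+; ↥p/↧p≡p; +-mono-≤; *-distribˡ-+; module ≤-Reasoning)
  open import Data.Rational.Unnormalised as U using (mkℚᵘ; _≃_; *≤*; *≡*)
  open import Data.Rational.Unnormalised.Properties using (≃-sym; ≃-trans; ≤-respˡ-≃; ≤-respʳ-≃; *-cong; +-cong)
  open import Data.Product using (∃; _,_)
  open import Relation.Binary.PropositionalEquality

  toℚᵘ-/ : ∀ x D → toℚᵘ (+ x / suc D) ≃ mkℚᵘ (+ x) D
  toℚᵘ-/ x D = toℚᵘ-fromℚᵘ (mkℚᵘ (+ x) D)

  +*+ : ∀ a b → + a ℤ.* + b ≡ + (a ℕ.* b)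
  +*+ a b = ℤ.+◃n≡+n (a ℕ.* b)

  /-mono : ∀ x y D E .{{_ : NonZero D}} .{{_ : NonZero E}} → x ℕ.* E ℕ.≤ y ℕ.* D → + x / D ≤ + y / E
  /-mono x y (suc D) (suc E) xE≤yD = toℚᵘ-cancel-≤
    (≤-respˡ-≃ (≃-sym (toℚᵘ-/ x D)) (≤-respʳ-≃ (≃-sym (toℚᵘ-/ y E))
      (*≤* (subst₂ ℤ._≤_ (sym (+*+ x (suc E))) (sym (+*+ y (suc D))) (ℤ.+≤+ xE≤yD)))))

  /-distrib-+ : ∀ x y D .{{_ : NonZero D}} → + (x ℕ.+ y) / D ≡ + x / D + + y / D
  /-distrib-+ x y (suc D) = toℚᵘ-injective (≃-trans (toℚᵘ-/ (x ℕ.+ y) D) (≃-trans (*≡* cross)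
    (≃-sym (≃-trans (toℚᵘ-homo-+ (+ x / suc D) (+ y / suc D)) (+-cong (toℚᵘ-/ x D) (toℚᵘ-/ y D))))))
    where
    open ≡-Reasoning
    expand : ∀ x y D → (x ℕ.+ y) ℕ.* (suc D ℕ.* suc D) ≡ (x ℕ.* suc D ℕ.+ y ℕ.* suc D) ℕ.* suc D
    expand = solve-∀
    cross : + (x ℕ.+ y) ℤ.* + (suc D ℕ.* suc D) ≡ (+ x ℤ.* + suc D ℤ.+ + y ℤ.* + suc D) ℤ.* + suc D
    cross = begin
      + (x ℕ.+ y) ℤ.* + (suc D ℕ.* suc D)               ≡⟨ +*+ (x ℕ.+ y) _ ⟩
      + ((x ℕ.+ y) ℕ.* (suc D ℕ.* suc D))               ≡⟨ cong +_ (expand x y D) ⟩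
      + ((x ℕ.* suc D ℕ.+ y ℕ.* suc D) ℕ.* suc D)       ≡⟨ +*+ (x ℕ.* suc D ℕ.+ y ℕ.* suc D) (suc D) ⟨
      + (x ℕ.* suc D ℕ.+ y ℕ.* suc D) ℤ.* + suc D       ≡⟨ cong (ℤ._* + suc D) (ℤ.pos-+ (x ℕ.* suc D) (y ℕ.* suc D)) ⟩
      (+ (x ℕ.* suc D) ℤ.+ + (y ℕ.* suc D)) ℤ.* + suc D ≡⟨ cong₂ (λ a b → (a ℤ.+ b) ℤ.* + suc D) (+*+ x (suc D)) (+*+ y (suc D)) ⟨
      (+ x ℤ.* + suc D ℤ.+ + y ℤ.* + suc D) ℤ.* + suc D ∎

  *-1/ : ∀ y D .{{_ : NonZero D}} → (+ y / 1) * (+ 1 / D) ≡ + y / D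
  *-1/ y (suc D) = toℚᵘ-injective (≃-trans (toℚᵘ-homo-* (+ y / 1) (+ 1 / suc D))
    (≃-trans (*-cong (toℚᵘ-/ y 0) (toℚᵘ-/ 1 D)) (≃-trans (*≡* cross) (≃-sym (toℚᵘ-/ y D)))))
    where
    open ≡-Reasoning
    unit : ∀ y D → y ℕ.* 1 ℕ.* suc D ≡ y ℕ.* suc (D ℕ.+ 0)
    unit = solve-∀
    cross : (+ y ℤ.* + 1) ℤ.* + suc D ≡ + y ℤ.* + suc (D ℕ.+ 0)
    cross = begin
      (+ y ℤ.* + 1) ℤ.* + suc D  ≡⟨ cong (ℤ._* + suc D) (+*+ y 1) ⟩
      + (y ℕ.* 1) ℤ.* + suc D    ≡⟨ +*+ (y ℕ.* 1) (suc D) ⟩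
      + (y ℕ.* 1 ℕ.* suc D)      ≡⟨ cong +_ (unit y D) ⟩
      + (y ℕ.* suc (D ℕ.+ 0))    ≡⟨ +*+ y (suc (D ℕ.+ 0)) ⟨
      + y ℤ.* + suc (D ℕ.+ 0)    ∎

  positive-fraction : (ε : ℚ) → 0ℚ < ε → ∃ λ p → ∃ λ d → ε ≡ + suc p / suc d
  positive-fraction ε@(mkℚ (+ suc p) d _) _ = p , d , sym (↥p/↧p≡p ε)
  positive-fraction (mkℚ (+ zero) d _) (*<* (ℤ.+<+ ()))
  positive-fraction (mkℚ -[1+ p ] d _) (*<* ())

  2^-nonZero : ∀ m → NonZero (2 ^ m)
  2^-nonZero m = ℕ.m^n≢0 2 m

  /2^-≤-half^ : ∀ Z k e m → Z ℕ.* 2 ^ e ℕ.≤ k ℕ.* 2 ^ m → (+ Z / 2 ^ m) {{2^-nonZero m}} ≤ (+ k / 1) * half^ e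
  /2^-≤-half^ Z k e m h = subst ((+ Z / 2 ^ m) {{2^-nonZero m}} ≤_) (sym (*-1/ k (2 ^ e) {{2^-nonZero e}}))
    (/-mono Z k (2 ^ m) (2 ^ e) {{2^-nonZero m}} {{2^-nonZero e}} h)

  five-part-bound : ∀ N m Z₁ Z₂ Z₃ Z₄ Z₅ k e₁ e₂ e₃ e₄ p d →
    N ℕ.≤ ((Z₁ ℕ.+ Z₂) ℕ.+ (Z₃ ℕ.+ Z₄)) ℕ.+ Z₅ →
    Z₁ ℕ.* 2 ^ e₁ ℕ.≤ k ℕ.* 2 ^ m → Z₂ ℕ.* 2 ^ e₂ ℕ.≤ k ℕ.* 2 ^ m →
    Z₃ ℕ.* 2 ^ e₃ ℕ.≤ 6 ℕ.* 2 ^ m → Z₄ ℕ.* 2 ^ e₄ ℕ.≤ 6 ℕ.* 2 ^ m → Z₅ ℕ.* suc d ℕ.≤ 2 ^ m →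
    (+ N / 2 ^ m) {{2^-nonZero m}}
      ≤ (+ k / 1) * (half^ e₁ + half^ e₂) + (+ 6 / 1) * (half^ e₃ + half^ e₄) + + suc p / suc d
  five-part-bound N m Z₁ Z₂ Z₃ Z₄ Z₅ k e₁ e₂ e₃ e₄ p d N≤ h₁ h₂ h₃ h₄ h₅ = begin
    + N / D                                             ≤⟨ /-mono N (((Z₁ ℕ.+ Z₂) ℕ.+ (Z₃ ℕ.+ Z₄)) ℕ.+ Z₅) D D (ℕ.*-monoˡ-≤ D N≤) ⟩
    + ((Z₁ ℕ.+ Z₂) ℕ.+ (Z₃ ℕ.+ Z₄) ℕ.+ Z₅) / D
      ≡⟨ trans (/-distrib-+ ((Z₁ ℕ.+ Z₂) ℕ.+ (Z₃ ℕ.+ Z₄)) Z₅ D) (cong (_+ + Z₅ / D) (trans (/-distrib-+ (Z₁ ℕ.+ Z₂) (Z₃ ℕ.+ Z₄) D)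
           (cong₂ _+_ (/-distrib-+ Z₁ Z₂ D) (/-distrib-+ Z₃ Z₄ D)))) ⟩
    ((+ Z₁ / D + + Z₂ / D) + (+ Z₃ / D + + Z₄ / D)) + + Z₅ / D
      ≤⟨ +-mono-≤ (+-mono-≤ (+-mono-≤ (/2^-≤-half^ Z₁ k e₁ m h₁) (/2^-≤-half^ Z₂ k e₂ m h₂))
                            (+-mono-≤ (/2^-≤-half^ Z₃ 6 e₃ m h₃) (/2^-≤-half^ Z₄ 6 e₄ m h₄)))
                  (/-mono Z₅ (suc p) D (suc d) (ℕ.≤-trans h₅ (ℕ.m≤m+n (2 ^ m) (p ℕ.* 2 ^ m)))) ⟩
    ((k′ * half^ e₁ + k′ * half^ e₂) + (six * half^ e₃ + six * half^ e₄)) + + suc p / suc d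
      ≡⟨ cong (_+ + suc p / suc d) (sym (cong₂ _+_ (*-distribˡ-+ k′ (half^ e₁) (half^ e₂))
                                                   (*-distribˡ-+ six (half^ e₃) (half^ e₄)))) ⟩
    k′ * (half^ e₁ + half^ e₂) + six * (half^ e₃ + half^ e₄) + + suc p / suc d ∎
    where
    open ≤-Reasoning
    D : ℕ
    D = 2 ^ m
    instance
      2^m≢0 : NonZero (2 ^ m)
      2^m≢0 = 2^-nonZero m
    k′ : ℚ
    k′ = + k / 1
    six : ℚ
    six = + 6 / 1

module Sumsets where

  open import Defs
  open Coins
  open Series using (sumBelow)
  open import Data.Bool using (Bool; true; false; T; not; _∨_)
  open import Data.Bool.Properties using (T-∧)
  open import Data.Nat using (ℕ; zero; suc; _+_; _*_; _∸_; _^_; _≤_; _<_; s≤s)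
  open import Data.Nat.Properties
  open import Data.Nat.Tactic.RingSolver using (solve-∀)
  open import Data.Vec using (Vec)
  open import Data.List using (length; filter)
  open import Data.Sum using (inj₁; inj₂)
  open import Data.Product using (_×_; _,_; proj₁)
  open import Data.Empty using (⊥-elim)
  open import Function.Bundles using (Equivalence)
  open import Relation.Nullary using (¬_; Dec; yes; no; does)
  open import Relation.Nullary.Decidable using (¬?; T?; decidable-stable)
  open import Relation.Binary.PropositionalEquality

  open Equivalence using (from)

  ∨-introˡ : ∀ a {b} → T a → T (a ∨ b)
  ∨-introˡ true _ = _

  ∨-introʳ : ∀ a {b} → T b → T (a ∨ b)
  ∨-introʳ true  _  = _
  ∨-introʳ false tb = tb

  refuted : ∀ {P : Set} (P? : Dec P) → T (not (does P?)) → ¬ P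
  refuted (yes _)  ()
  refuted (no ¬p) _ = ¬p

  confirmed : ∀ {P : Set} (P? : Dec P) → ¬ T (not (does P?)) → P
  confirmed (yes p) _   = p
  confirmed (no _)  ¬tt = ⊥-elim (¬tt _)

  module _ (n m : ℕ) (L R : NSet) where

    S : Vec Bool m → NSet
    S v = Sset n m L R v

    coin∈S : ∀ v p → T (lookupℕ v p) → (n + p) ∈ S v
    coin∈S v p heads = ∨-introʳ (L (n + p)) (∨-introˡ (embed n v (n + p)) (from T-∧
      (≤⇒≤ᵇ (m≤m+n n p) , subst (λ i → T (lookupℕ v i)) (sym (m+n∸m≡n n p)) heads)))

    L∈S : ∀ v l → l ∈ L → (0 + l) ∈ S v
    L∈S v l l∈L = ∨-introˡ (L l) l∈L

    R∈S : ∀ v r → r ∈ R → (m + r) ∈ S v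
    R∈S v r r∈R = ∨-introʳ (L (m + r)) (∨-introʳ (embed n v (m + r)) (from T-∧
      (≤⇒≤ᵇ (m≤m+n m r) , subst (λ i → T (R i)) (sym (m+n∸m≡n m r)) r∈R)))

    missed : ℕ → Vec Bool m → Bool
    missed x v = not (does (sum? (S v) (S v) x))

    missed-sound : ∀ x v → T (missed x v) → ¬ (x ∈ S v ⊕ S v)
    missed-sound x v = refuted (sum? (S v) (S v) x)

    missed-complete : ∀ x v → ¬ T (missed x v) → x ∈ S v ⊕ S v
    missed-complete x v = confirmed (sum? (S v) (S v) x)

    pairs-hit : ∀ x lo d → n + n + (lo + lo + d) ≡ suc x →
      ∀ p p' → suc (p + p') ≡ lo + lo + d → n + p + (n + p') ≡ x
    pairs-hit x lo d target p p' sum = suc-injective (trans (regroup n p p') (trans (cong (n + n +_) sum) target))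
      where
      regroup : ∀ n p p' → suc (n + p + (n + p')) ≡ n + n + suc (p + p')
      regroup = solve-∀

    missed-bound : ∀ x lo d B k A o → lo + d ≤ m →
      (∀ l → l < k → T (A l) → l ≤ B × B ∸ l < m × Outside lo d (B ∸ l)) →
      (∀ p p' → suc (p + p') ≡ lo + lo + d → n + p + (n + p') ≡ x) →
      (∀ v l → l < k → T (A l) → (o + l) ∈ S v) →
      (∀ l → l < k → T (A l) → B + (n + o) ≡ x) →
      #sat m (missed x) * 2 ^ d * 2 ^ count k A ≤ pairFree d * 2 ^ m
    missed-bound x lo d B k A o end≤m coins pairs-hit partner partners-hit =
      destroyed-event-bound m lo d B k A (missed x) end≤m coins
        (λ v miss p p' hp hp' sum → missed-sound x v miss
           (n + p , n + p' , coin∈S v p hp , coin∈S v p' hp' , pairs-hit p p' sum))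
        (λ v miss l l<k Al hb → missed-sound x v miss
           (o + l , n + (B ∸ l) , partner v l l<k Al , coin∈S v (B ∸ l) hb ,
            mixed-sum (proj₁ (coins l l<k Al)) (partners-hit l l<k Al)))
      where
      regroup : ∀ l o n z → o + l + (n + z) ≡ l + z + (n + o)
      regroup = solve-∀
      mixed-sum : ∀ {l} → l ≤ B → B + (n + o) ≡ x → o + l + (n + (B ∸ l)) ≡ x
      mixed-sum {l} l≤B hit = trans (regroup l o n (B ∸ l)) (trans (cong (_+ (n + o)) (m+[n∸m]≡n l≤B)) hit)

    anyMissed : ℕ → ℕ → Vec Bool m → Bool
    anyMissed X zero    v = false
    anyMissed X (suc N) v = anyMissed X N v ∨ missed (X + N) v

    #sat-anyMissed : ∀ X N → #sat m (anyMissed X N) ≤ sumBelow N (λ j → #sat m (missed (X + j)))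
    #sat-anyMissed X zero    = ≤-reflexive (#sat-false m)
    #sat-anyMissed X (suc N) = ≤-trans (#sat-∨ m (anyMissed X N) (missed (X + N)))
                                       (+-monoˡ-≤ (#sat m (missed (X + N))) (#sat-anyMissed X N))

    anyMissed-complete : ∀ X N v → ¬ T (anyMissed X N v) → ∀ j → j < N → (X + j) ∈ S v ⊕ S v
    anyMissed-complete X (suc N) v none j j<1+N with m<1+n⇒m<n∨m≡n j<1+N
    ... | inj₁ j<N  = anyMissed-complete X N v (λ some → none (∨-introˡ (anyMissed X N v) some)) j j<N
    ... | inj₂ refl = missed-complete (X + j) v (λ miss → none (∨-introʳ (anyMissed X N v) miss))

    uncovered-bound : ∀ lo hi N → suc hi ≡ lo + N →
      length (filter (λ v → ¬? (interval? lo hi (S v) (S v))) (allVecs m))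
        ≤ sumBelow N (λ j → #sat m (missed (lo + j)))
    uncovered-bound lo hi N end≡ = ≤-trans
      (length-filter-allVecs m _ (anyMissed lo N) (λ v uncovered → decidable-stable (T? _) (λ none →
         uncovered (λ x lo≤x x≤hi → subst (λ y → y ∈ S v ⊕ S v) (m+[n∸m]≡n lo≤x)
           (anyMissed-complete lo N v none (x ∸ lo)
             (+-cancelˡ-< lo (x ∸ lo) N (subst (_≤ lo + N) (cong suc (sym (m+[n∸m]≡n lo≤x)))
                (subst (suc x ≤_) end≡ (s≤s x≤hi)))))))))
      (#sat-anyMissed lo N)

module UnionBound where

  open import Defs
  open Coins using (#sat; pairFree; Outside)
  open Series
  open Sumsets
  open import Data.Bool using (T; _∧_)
  open import Data.Bool.Properties using (T-∧)
  open import Data.Nat using (ℕ; suc; _+_; _*_; _∸_; _^_; _≤_; _<_; s≤s; z≤n; s≤s⁻¹; _≤ᵇ_)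
  open import Data.Nat.Properties
  open import Data.Nat.Tactic.RingSolver using (solve-∀)
  open import Data.Sum using (inj₁; inj₂)
  open import Data.Product using (_×_; _,_; proj₁; proj₂)
  open import Function.Bundles using (Equivalence)
  open import Relation.Binary.PropositionalEquality
  open import Data.List using (length; filter)
  open import Relation.Nullary.Decidable using (¬?)
  open Fractions using (five-part-bound)
  import Data.Integer as ℤ
  open import Data.Rational as ℚ using (_/_) renaming (_≤_ to _≤ℚ_)

  open Equivalence using (to)

  -- The parameters: n = 1 + a₁ + e and a = 2 + a₁; m is determined by the
  -- extra length w and by q = 1 + den, the reciprocal of the error allowed for
  -- the middle zone.
  module Zones (a₁ e w den : ℕ) (L R : NSet)
    (L⊆ : L ⊆[ 0 , suc (a₁ + e) ∸ 1 ]) (R⊆ : R ⊆[ suc (a₁ + e) , 2 * suc (a₁ + e) ∸ 1 ]) where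

    n₁ : ℕ
    n₁ = a₁ + e
    n : ℕ
    n = suc n₁
    q : ℕ
    q = suc den
    a : ℕ
    a = 2 + a₁

    -- sizes of the zones: Nm middle points, Nb points in each boundary zone
    Nm : ℕ
    Nm = suc (n₁ + n₁)
    t : ℕ
    t = 3 * (Nm * q)
    Nb : ℕ
    Nb = suc (2 * n + 2 * t + w)
    m : ℕ
    m = Nb + n₁

    -- the interval [2n - a + 1 , 2n + 2m + a - 3] is [X₀ , X₀ + Ntot)
    X₀ : ℕ
    X₀ = suc (a₁ + e + e)
    Ntot : ℕ
    Ntot = a₁ + (Nb + (Nm + (Nb + a₁)))

    y : ℕ → ℕ
    y j = #sat m (missed n m L R (X₀ + j))

    L-bound : ∀ l → l ∈ L → l ≤ n₁
    L-bound l l∈L = proj₂ (L⊆ l l∈L)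

    R-bound : ∀ r → r ∈ R → n ≤ r × r ≤ n + n₁
    R-bound r r∈R = proj₁ (R⊆ r r∈R) , subst (r ≤_) twice-n∸1 (proj₂ (R⊆ r r∈R))
      where
      twice-n∸1 : 2 * n ∸ 1 ≡ n + n₁
      twice-n∸1 = trans (cong (_∸ 1) (expand a₁ e)) (m+n∸n≡m (n + n₁) 1)
        where
        expand : ∀ a₁ e → 2 * suc (a₁ + e) ≡ suc (a₁ + e) + (a₁ + e) + 1
        expand = solve-∀

    Nb≤m : Nb ≤ m
    Nb≤m = m≤m+n Nb n₁

    n₁≤m : n₁ ≤ m
    n₁≤m = m≤n+m n₁ Nb

    Lτ : NSet
    Lτ i = L i ∧ (i ≤ᵇ n + 1 ∸ a)

    Lτ-bound : ∀ l → T (Lτ l) → l ∈ L × l ≤ e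
    Lτ-bound l l∈ = proj₁ (to T-∧ l∈) , subst (l ≤_) n+1∸a≡e (≤ᵇ⇒≤ l (n + 1 ∸ a) (proj₂ (to T-∧ l∈)))
      where
      expand : ∀ a₁ e → suc (a₁ + e) + 1 ≡ e + (2 + a₁)
      expand = solve-∀
      n+1∸a≡e : n + 1 ∸ a ≡ e
      n+1∸a≡e = trans (cong (_∸ a) (expand a₁ e)) (m+n∸n≡m e a)

    -- Zone A, the a - 2 points X₀ + j (j < a - 2): for every l ∈ Lτ the point is
    -- l + (n + (e + j - l)), so it is missed with probability at most 2^-τ(L).
    zoneA : ∀ j → j < a₁ → y j * 2 ^ τL n L a ≤ 2 ^ m
    zoneA j j<a₁ = subst₂ _≤_ (cong (_* 2 ^ τL n L a) (*-identityʳ (y j))) (+-identityʳ (2 ^ m))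
      (missed-bound n m L R (X₀ + j) 0 0 (e + j) n Lτ 0 z≤n coins (λ _ _ ())
         (λ v l _ l∈ → L∈S n m L R v l (proj₁ (Lτ-bound l l∈))) (λ _ _ _ → hit a₁ e j))
      where
      hit : ∀ a₁ e j → e + j + (suc (a₁ + e) + 0) ≡ suc (a₁ + e + e) + j
      hit = solve-∀
      e+j<m : e + j < m
      e+j<m = <-≤-trans (+-monoʳ-< e j<a₁) (subst (_≤ m) (+-comm a₁ e) n₁≤m)
      coins : ∀ l → l < n → T (Lτ l) → l ≤ e + j × e + j ∸ l < m × Outside 0 0 (e + j ∸ l)
      coins l _ l∈ = ≤-trans (proj₂ (Lτ-bound l l∈)) (m≤m+n e j) , ≤-<-trans (m∸n≤m (e + j) l) e+j<m , inj₂ z≤n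

    -- Zone B, the Nb points X₀ + a₁ + j = 2n - 1 + j (j < Nb): each symmetric pair
    -- of coins of the window [0 , j) hits the point, and so does l + (n + (n₁ + j - l))
    -- for every l ∈ L, where the coins n₁ + j - l ≥ j lie beyond the window.
    zoneB : ∀ j → j < Nb → y (a₁ + j) * 2 ^ j * 2 ^ count n L ≤ pairFree j * 2 ^ m
    zoneB j j<Nb = missed-bound n m L R (X₀ + (a₁ + j)) 0 j (n₁ + j) n L 0 (≤-trans (<⇒≤ j<Nb) Nb≤m) coins
      (pairs-hit n m L R (X₀ + (a₁ + j)) 0 j (pair-target a₁ e j))
      (λ v l _ l∈L → L∈S n m L R v l l∈L) (λ _ _ _ → hit a₁ e j)
      where
      pair-target : ∀ a₁ e j → suc (a₁ + e) + suc (a₁ + e) + (0 + 0 + j) ≡ suc (suc (a₁ + e + e) + (a₁ + j))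
      pair-target = solve-∀
      hit : ∀ a₁ e j → a₁ + e + j + (suc (a₁ + e) + 0) ≡ suc (a₁ + e + e) + (a₁ + j)
      hit = solve-∀
      coins : ∀ l → l < n → T (L l) → l ≤ n₁ + j × n₁ + j ∸ l < m × Outside 0 j (n₁ + j ∸ l)
      coins l _ l∈L = ≤-trans (L-bound l l∈L) (m≤m+n n₁ j)
                    , ≤-<-trans (m∸n≤m (n₁ + j) l) (subst (n₁ + j <_) (+-comm n₁ Nb) (+-monoʳ-< n₁ j<Nb))
                    , inj₂ (subst (j ≤_) (sym (+-∸-comm j (L-bound l l∈L))) (m≤n+m j (n₁ ∸ l)))

    -- Zone M, the Nm middle points X₀ + a₁ + Nb + j (j < Nm): the symmetric pairs of
    -- the window [j , Nb) hit the point; the window has length d ≥ 2t, so the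
    -- point is missed with probability at most (3/4)ᵗ.
    zoneM : ∀ j → j < Nm → y (a₁ + (Nb + j)) * 4 ^ t ≤ 3 ^ t * 2 ^ m
    zoneM j j<Nm = pairFree-small (y (a₁ + (Nb + j))) (2 ^ m) t d (m≤m+n (2 * t) (w + 3 + g))
      (subst (_≤ pairFree d * 2 ^ m) (*-identityʳ _)
        (missed-bound n m L R (X₀ + (a₁ + (Nb + j))) j d 0 0 L 0 (≤-trans (≤-reflexive window-end) Nb≤m)
           (λ _ ()) (pairs-hit n m L R (X₀ + (a₁ + (Nb + j))) j d pair-target) (λ _ _ ()) (λ _ ())))
      where
      open ≡-Reasoning
      g : ℕ
      g = n₁ + n₁ ∸ j
      j+g : j + g ≡ n₁ + n₁
      j+g = m+[n∸m]≡n (s≤s⁻¹ j<Nm)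
      d : ℕ
      d = 2 * t + (w + 3 + g)
      regroup₁ : ∀ j t w g → j + (2 * t + (w + 3 + g)) ≡ (j + g) + (2 * t + w + 3)
      regroup₁ = solve-∀
      close₁ : ∀ a₁ e t w → a₁ + e + (a₁ + e) + (2 * t + w + 3) ≡ suc (2 * suc (a₁ + e) + 2 * t + w)
      close₁ = solve-∀
      window-end : j + d ≡ Nb
      window-end = begin
        j + d                               ≡⟨ regroup₁ j t w g ⟩
        (j + g) + (2 * t + w + 3)           ≡⟨ cong (_+ (2 * t + w + 3)) j+g ⟩
        (n₁ + n₁) + (2 * t + w + 3)         ≡⟨ close₁ a₁ e t w ⟩
        Nb                                  ∎
      regroup₂ : ∀ n j t w g → n + n + (j + j + (2 * t + (w + 3 + g))) ≡ n + n + j + (j + g) + (2 * t + w + 3)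
      regroup₂ = solve-∀
      close₂ : ∀ a₁ e j t w → suc (a₁ + e) + suc (a₁ + e) + j + (a₁ + e + (a₁ + e)) + (2 * t + w + 3)
                            ≡ suc (suc (a₁ + e + e) + (a₁ + (suc (2 * suc (a₁ + e) + 2 * t + w) + j)))
      close₂ = solve-∀
      pair-target : n + n + (j + j + d) ≡ suc (X₀ + (a₁ + (Nb + j)))
      pair-target = begin
        n + n + (j + j + d)                     ≡⟨ regroup₂ n j t w g ⟩
        n + n + j + (j + g) + (2 * t + w + 3)   ≡⟨ cong (λ s → n + n + j + s + (2 * t + w + 3)) j+g ⟩
        n + n + j + (n₁ + n₁) + (2 * t + w + 3) ≡⟨ close₂ a₁ e j t w ⟩
        suc (X₀ + (a₁ + (Nb + j)))              ∎

    -- Zone B', the mirror image of zone B: the Nb points X₀ + a₁ + Nb + Nm + jj, read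
    -- backwards (jj = Nb - 1 - i), are hit by the symmetric pairs of the window
    -- [m - i , m) and by (m + r) + (n + (n + n₁ + jj - r)) for every r ∈ R.
    zoneB' : ∀ i → i < Nb → y (a₁ + (Nb + (Nm + (Nb ∸ suc i)))) * 2 ^ i * 2 ^ count (2 * n) R ≤ pairFree i * 2 ^ m
    zoneB' i i<Nb = missed-bound n m L R x lo i B (2 * n) R m (≤-reflexive window-end) coins
      (pairs-hit n m L R x lo i pair-target) (λ v r _ r∈R → R∈S n m L R v r r∈R) (λ _ _ _ → hit a₁ e jj Nb)
      where
      jj : ℕ
      jj = Nb ∸ suc i
      i+jj : suc i + jj ≡ Nb
      i+jj = m+[n∸m]≡n i<Nb
      x : ℕ
      x = X₀ + (a₁ + (Nb + (Nm + jj)))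
      lo : ℕ
      lo = suc (jj + n₁)
      B : ℕ
      B = n + n₁ + jj
      regroup : ∀ jj n₁ i → suc (jj + n₁) + i ≡ suc i + jj + n₁
      regroup = solve-∀
      window-end : lo + i ≡ m
      window-end = trans (regroup jj n₁ i) (cong (_+ n₁) i+jj)
      expand : ∀ a₁ e jj i → suc (a₁ + e) + suc (a₁ + e) + (suc (jj + (a₁ + e)) + suc (jj + (a₁ + e)) + i)
                           ≡ suc (suc (a₁ + e + e) + (a₁ + ((suc i + jj) + (suc (a₁ + e + (a₁ + e)) + jj))))
      expand = solve-∀
      pair-target : n + n + (lo + lo + i) ≡ suc x
      pair-target = trans (expand a₁ e jj i) (cong (λ N → suc (X₀ + (a₁ + (N + (Nm + jj))))) i+jj)
      hit : ∀ a₁ e jj Nb → suc (a₁ + e) + (a₁ + e) + jj + (suc (a₁ + e) + (Nb + (a₁ + e)))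
                         ≡ suc (a₁ + e + e) + (a₁ + (Nb + (suc (a₁ + e + (a₁ + e)) + jj)))
      hit = solve-∀
      B∸n : B ∸ n ≡ n₁ + jj
      B∸n = trans (cong (_∸ n) (+-assoc n n₁ jj)) (m+n∸m≡n n (n₁ + jj))
      B∸r<lo : ∀ r → r ∈ R → B ∸ r < lo
      B∸r<lo r r∈R = s≤s (≤-trans (∸-monoʳ-≤ B (proj₁ (R-bound r r∈R))) (≤-reflexive (trans B∸n (+-comm n₁ jj))))
      coins : ∀ r → r < 2 * n → T (R r) → r ≤ B × B ∸ r < m × Outside lo i (B ∸ r)
      coins r _ r∈R = ≤-trans (proj₂ (R-bound r r∈R)) (m≤m+n (n + n₁) jj)
                    , <-≤-trans (B∸r<lo r r∈R) (≤-trans (m≤m+n lo i) (≤-reflexive window-end))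
                    , inj₁ (B∸r<lo r r∈R)

    Rτ : NSet
    Rτ i = R i ∧ (n + a ∸ 2 ≤ᵇ i)

    Rτ-bound : ∀ r → T (Rτ r) → r ∈ R × n + a₁ ≤ r
    Rτ-bound r r∈ = proj₁ (to T-∧ r∈) , subst (_≤ r) n+a∸2≡n+a₁ (≤ᵇ⇒≤ (n + a ∸ 2) r (proj₂ (to T-∧ r∈)))
      where
      expand : ∀ a₁ e → suc (a₁ + e) + (2 + a₁) ≡ suc (a₁ + e) + a₁ + 2
      expand = solve-∀
      n+a∸2≡n+a₁ : n + a ∸ 2 ≡ n + a₁
      n+a∸2≡n+a₁ = trans (cong (_∸ 2) (expand a₁ e)) (m+n∸n≡m (n + a₁) 2)

    -- Zone A', the mirror image of zone A: the last a - 2 points are hit by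
    -- (m + r) + (n + (n + m + j - r)) for every r ∈ Rτ.
    zoneA' : ∀ j → j < a₁ → y (a₁ + (Nb + (Nm + (Nb + j)))) * 2 ^ τR n R a ≤ 2 ^ m
    zoneA' j j<a₁ = subst₂ _≤_ (cong (_* 2 ^ τR n R a) (*-identityʳ (y (a₁ + (Nb + (Nm + (Nb + j))))))) (+-identityʳ (2 ^ m))
      (missed-bound n m L R (X₀ + (a₁ + (Nb + (Nm + (Nb + j))))) 0 0 B (2 * n) Rτ m z≤n coins (λ _ _ ())
         (λ v r _ r∈ → R∈S n m L R v r (proj₁ (Rτ-bound r r∈))) (λ _ _ _ → hit a₁ e j Nb))
      where
      B : ℕ
      B = n + m + j
      hit : ∀ a₁ e j Nb → suc (a₁ + e) + (Nb + (a₁ + e)) + j + (suc (a₁ + e) + (Nb + (a₁ + e)))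
                        ≡ suc (a₁ + e + e) + (a₁ + (Nb + (suc (a₁ + e + (a₁ + e)) + (Nb + j))))
      hit = solve-∀
      below : ∀ m′ → suc m′ + j ∸ a₁ < suc m′
      below m′ = ≤-<-trans (∸-monoʳ-≤ (suc m′ + j) j<a₁) (s≤s (≤-reflexive (m+n∸n≡m m′ j)))
      B∸r<m : ∀ r → T (Rτ r) → B ∸ r < m
      B∸r<m r r∈ = ≤-<-trans (∸-monoʳ-≤ B (proj₂ (Rτ-bound r r∈)))
        (subst (_< m) (sym (trans (cong (_∸ (n + a₁)) (+-assoc n m j)) ([m+n]∸[m+o]≡n∸o n (m + j) a₁)))
          (below (2 * n + 2 * t + w + n₁)))
      coins : ∀ r → r < 2 * n → T (Rτ r) → r ≤ B × B ∸ r < m × Outside 0 0 (B ∸ r)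
      coins r _ r∈ = ≤-trans (proj₂ (R-bound r (proj₁ (Rτ-bound r r∈)))) (≤-trans (+-monoʳ-≤ n n₁≤m) (m≤m+n (n + m) j))
                   , B∸r<m r r∈ , inj₂ z≤n

    ZA : ℕ
    ZA = sumBelow a₁ y
    ZB : ℕ
    ZB = sumBelow Nb (λ j → y (a₁ + j))
    ZM : ℕ
    ZM = sumBelow Nm (λ j → y (a₁ + (Nb + j)))
    ZB' : ℕ
    ZB' = sumBelow Nb (λ j → y (a₁ + (Nb + (Nm + j))))
    ZA' : ℕ
    ZA' = sumBelow a₁ (λ j → y (a₁ + (Nb + (Nm + (Nb + j)))))

    zones-split : sumBelow Ntot y ≡ ZA + (ZB + (ZM + (ZB' + ZA')))
    zones-split = trans (sumBelow-++ a₁ _ y) (cong (ZA +_) (trans (sumBelow-++ Nb _ _) (cong (ZB +_)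
      (trans (sumBelow-++ Nm _ _) (cong (ZM +_) (sumBelow-++ Nb a₁ _))))))

    ZA-bound : ZA * 2 ^ τL n L a ≤ a₁ * 2 ^ m
    ZA-bound = sumBelow-bound a₁ y (2 ^ τL n L a) (2 ^ m) zoneA

    ZB-bound : ZB * 2 ^ count n L ≤ 6 * 2 ^ m
    ZB-bound = pairFree-series Nb (λ j → y (a₁ + j)) (count n L) m zoneB

    ZM-bound : ZM * q ≤ 2 ^ m
    ZM-bound = decaying-series Nm q (2 ^ m) (λ j → y (a₁ + (Nb + j))) zoneM

    ZB'-bound : ZB' * 2 ^ count (2 * n) R ≤ 6 * 2 ^ m
    ZB'-bound = subst (λ Z → Z * 2 ^ count (2 * n) R ≤ 6 * 2 ^ m)
      (sym (sumBelow-reverse Nb (λ j → y (a₁ + (Nb + (Nm + j))))))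
      (pairFree-series Nb _ (count (2 * n) R) m zoneB')

    ZA'-bound : ZA' * 2 ^ τR n R a ≤ a₁ * 2 ^ m
    ZA'-bound = sumBelow-bound a₁ _ (2 ^ τR n R a) (2 ^ m) zoneA'

    first≡ : 2 * n + 1 ∸ a ≡ X₀
    first≡ = trans (cong (_∸ a) (expand a₁ e)) (m+n∸n≡m X₀ a)
      where
      expand : ∀ a₁ e → 2 * suc (a₁ + e) + 1 ≡ suc (a₁ + e + e) + (2 + a₁)
      expand = solve-∀

    end≡ : suc (2 * n + 2 * m + a ∸ 3) ≡ (2 * n + 1 ∸ a) + Ntot
    end≡ = trans (cong suc (trans (cong (_∸ 3) (expand a₁ e Nb)) (m+n∸n≡m (a₁ + e + e + Ntot) 3)))
                 (cong (_+ Ntot) (sym first≡))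
      where
      expand : ∀ a₁ e Nb → 2 * suc (a₁ + e) + 2 * (Nb + (a₁ + e)) + (2 + a₁)
                         ≡ a₁ + e + e + (a₁ + (Nb + (suc (a₁ + e + (a₁ + e)) + (Nb + a₁)))) + 3
      expand = solve-∀

    uncovered≤zones : length (filter (λ v → ¬? (interval? (2 * n + 1 ∸ a) (2 * n + 2 * m + a ∸ 3) (S n m L R v) (S n m L R v))) (allVecs m))
                      ≤ ((ZA' + ZA) + (ZB + ZB')) + ZM
    uncovered≤zones = ≤-trans
      (subst (λ X → length (filter (λ v → ¬? (interval? (2 * n + 1 ∸ a) (2 * n + 2 * m + a ∸ 3) (S n m L R v) (S n m L R v))) (allVecs m))
                    ≤ sumBelow Ntot (λ j → #sat m (missed n m L R (X + j))))
             first≡ (uncovered-bound n m L R (2 * n + 1 ∸ a) (2 * n + 2 * m + a ∸ 3) Ntot end≡))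
      (≤-reflexive (trans zones-split (reorder ZA ZB ZM ZB' ZA')))
      where
      reorder : ∀ a b c d e → a + (b + (c + (d + e))) ≡ ((e + a) + (b + d)) + c
      reorder = solve-∀

    failure-bound : ∀ p →
      prob m (λ v → ¬? (interval? (2 * n + 1 ∸ a) (2 * n + 2 * m + a ∸ 3) (Sset n m L R v) (Sset n m L R v)))
        ≤ℚ (ℤ.+ a₁ / 1) ℚ.* (half^ (τR n R a) ℚ.+ half^ (τL n L a))
           ℚ.+ (ℤ.+ 6 / 1) ℚ.* (half^ (count n L) ℚ.+ half^ (count (2 * n) R))
           ℚ.+ ℤ.+ suc p / q
    failure-bound p = five-part-bound _ m ZA' ZA ZB ZB' ZM a₁ (τR n R a) (τL n L a) (count n L) (count (2 * n) R) p den
      uncovered≤zones ZA'-bound ZA-bound ZB-bound ZB'-bound ZM-bound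

open import Defs
open import Data.Nat using (ℕ; _∸_; _≤_; _<_) renaming (_+_ to _+ℕ_; _*_ to _*ℕ_)
open import Data.Integer using (+_)
open import Data.Rational using (ℚ; 0ℚ; _+_; _*_; _/_) renaming (_≤_ to _≤ℚ_; _<_ to _<ℚ_)
open import Data.Product using (∃; _×_)
open import Relation.Nullary.Decidable using (¬?)

open import Data.Nat using (zero; suc; s≤s; z≤n)
open import Data.Nat.Properties using (≤-trans; ≤-reflexive; <-irrefl; <⇒≱; m≤m+n; +-mono-≤; ∸-monoʳ-≤;
  m+n∸n≡m; m+[n∸m]≡n; _≤?_; ≰⇒>; n<1+n)
open import Data.Nat.Tactic.RingSolver using (solve-∀)
open import Data.Product using (_,_; proj₂)
open import Data.Empty using (⊥-elim)
open import Relation.Nullary using (¬_; yes; no)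
open import Relation.Binary.PropositionalEquality using (_≡_; refl; sym; trans; cong; subst; subst₂)
open Fractions using (positive-fraction)
open UnionBound using (module Zones)

2n-1∉L+L : ∀ n₁ L → L ⊆[ 0 , suc n₁ ∸ 1 ] → ¬ ((suc n₁ +ℕ n₁) ∈ L ⊕ L)
2n-1∉L+L n₁ L L⊆ (y , z , y∈L , z∈L , y+z≡) =
  <-irrefl refl (subst (_≤ n₁ +ℕ n₁) y+z≡ (+-mono-≤ (proj₂ (L⊆ y y∈L)) (proj₂ (L⊆ z z∈L))))

-- hence Cond fails for b ≤ 1, whose L-interval [n , 2n - b] contains 2n - 1
cond-needs-2 : ∀ n₁ L R b → L ⊆[ 0 , suc n₁ ∸ 1 ] → b ≤ 1 → ¬ Cond (suc n₁) L R b
cond-needs-2 n₁ L R b L⊆ b≤1 (L-covers , _) = 2n-1∉L+L n₁ L L⊆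
  (L-covers (suc n₁ +ℕ n₁) (m≤m+n (suc n₁) n₁) (≤-trans (≤-reflexive (sym 2n∸1≡)) (∸-monoʳ-≤ (2 *ℕ suc n₁) b≤1)))
  where
  expand : ∀ n₁ → 2 *ℕ suc n₁ ≡ suc n₁ +ℕ n₁ +ℕ 1
  expand = solve-∀
  2n∸1≡ : 2 *ℕ suc n₁ ∸ 1 ≡ suc n₁ +ℕ n₁
  2n∸1≡ = trans (cong (_∸ 1) (expand n₁)) (m+n∸n≡m (suc n₁ +ℕ n₁) 1)

empty-interval : ∀ {lo hi} A B → hi < lo → [ lo , hi ]⊆ A ⊕ B
empty-interval A B hi<lo x lo≤x x≤hi = ⊥-elim (<⇒≱ hi<lo (≤-trans lo≤x x≤hi))

-- Cond holds for b = n + 1, where both of its intervals are empty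
cond-at-n+1 : ∀ n₁ L R → Cond (suc n₁) L R (suc (suc n₁))
cond-at-n+1 n₁ L R = empty-interval L L (subst (_< suc n₁) (sym L-end) (n<1+n n₁))
                   , empty-interval R R (subst₂ _<_ (sym R-end) (sym R-start) (n<1+n _))
  where
  expand₁ : ∀ n₁ → 2 *ℕ suc n₁ ≡ n₁ +ℕ suc (suc n₁)
  expand₁ = solve-∀
  L-end : 2 *ℕ suc n₁ ∸ suc (suc n₁) ≡ n₁
  L-end = trans (cong (_∸ suc (suc n₁)) (expand₁ n₁)) (m+n∸n≡m n₁ (suc (suc n₁)))
  expand₂ : ∀ n₁ → 2 *ℕ suc n₁ +ℕ suc (suc n₁) ≡ suc (suc (3 *ℕ n₁)) +ℕ 2
  expand₂ = solve-∀
  R-start : 2 *ℕ suc n₁ +ℕ suc (suc n₁) ∸ 2 ≡ suc (suc (3 *ℕ n₁))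
  R-start = trans (cong (_∸ 2) (expand₂ n₁)) (m+n∸n≡m _ 2)
  expand₃ : ∀ n₁ → 3 *ℕ suc n₁ ≡ suc (3 *ℕ n₁) +ℕ 2
  expand₃ = solve-∀
  R-end : 3 *ℕ suc n₁ ∸ 2 ≡ suc (3 *ℕ n₁)
  R-end = trans (cong (_∸ 2) (expand₃ n₁)) (m+n∸n≡m _ 2)

-- so the smallest a lies in [2 , n + 1]: a = 2 + a₁ and n - 1 = a₁ + e
smallest-a : ∀ n₁ L R a → L ⊆[ 0 , suc n₁ ∸ 1 ] → IsSmallestA (suc n₁) L R a →
  ∃ λ a₁ → ∃ λ e → a ≡ 2 +ℕ a₁ × n₁ ≡ a₁ +ℕ e
smallest-a n₁ L R zero          L⊆ (cond , _) = ⊥-elim (cond-needs-2 n₁ L R 0 L⊆ z≤n cond)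
smallest-a n₁ L R (suc zero)    L⊆ (cond , _) = ⊥-elim (cond-needs-2 n₁ L R 1 L⊆ (s≤s z≤n) cond)
smallest-a n₁ L R (suc (suc a₁)) L⊆ (_ , minimal) with a₁ ≤? n₁
... | yes a₁≤n₁ = a₁ , n₁ ∸ a₁ , refl , sym (m+[n∸m]≡n a₁≤n₁)
... | no  a₁≰n₁ = ⊥-elim (minimal (suc (suc n₁)) (s≤s (s≤s (≰⇒> a₁≰n₁))) (cond-at-n+1 n₁ L R))

FailureBound : (n : ℕ) (L R : NSet) (a : ℕ) (ε : ℚ) (m : ℕ) → Set
FailureBound n L R a ε m =
  prob m (λ v → ¬? (interval? (2 *ℕ n +ℕ 1 ∸ a) (2 *ℕ n +ℕ 2 *ℕ m +ℕ a ∸ 3) (Sset n m L R v) (Sset n m L R v)))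
    ≤ℚ ((+ (a ∸ 2) / 1) * (half^ (τR n R a) + half^ (τL n L a))
        + (+ 6 / 1) * (half^ (count n L) + half^ (count (2 *ℕ n) R))
        + ε)

-- For n = 1 + a₁ + e, a = 2 + a₁ and ε = (1 + p) / (1 + den) the bound holds for
-- all m ≥ m₀ = Zones.m with w = 0, since such m is Zones.m with w = m - m₀.
eventually-bounded : ∀ a₁ e den p L R (L⊆ : L ⊆[ 0 , suc (a₁ +ℕ e) ∸ 1 ])
  (R⊆ : R ⊆[ suc (a₁ +ℕ e) , 2 *ℕ suc (a₁ +ℕ e) ∸ 1 ]) →
  ∃ λ m₀ → ∀ m → 0 < m → m₀ ≤ m → FailureBound (suc (a₁ +ℕ e)) L R (2 +ℕ a₁) (+ suc p / suc den) m
eventually-bounded a₁ e den p L R L⊆ R⊆ = m₀ , λ m _ m₀≤m →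
  subst (FailureBound (suc (a₁ +ℕ e)) L R (2 +ℕ a₁) (+ suc p / suc den)) (m≡ m m₀≤m)
        (Zones.failure-bound a₁ e (m ∸ m₀) den L R L⊆ R⊆ p)
  where
  m₀ : ℕ
  m₀ = Zones.m a₁ e 0 den L R L⊆ R⊆
  shift-w : ∀ n t n₁ w → suc (2 *ℕ n +ℕ 2 *ℕ t +ℕ w) +ℕ n₁ ≡ suc (2 *ℕ n +ℕ 2 *ℕ t +ℕ 0) +ℕ n₁ +ℕ w
  shift-w = solve-∀
  m≡ : ∀ m → m₀ ≤ m → Zones.m a₁ e (m ∸ m₀) den L R L⊆ R⊆ ≡ m
  m≡ m m₀≤m = trans (shift-w (suc (a₁ +ℕ e)) (Zones.t a₁ e 0 den L R L⊆ R⊆) (a₁ +ℕ e) (m ∸ m₀)) (m+[n∸m]≡n m₀≤m)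

bounded-for-parameters : ∀ n₁ L R a ε → L ⊆[ 0 , suc n₁ ∸ 1 ] → R ⊆[ suc n₁ , 2 *ℕ suc n₁ ∸ 1 ] →
  (∃ λ a₁ → ∃ λ e → a ≡ 2 +ℕ a₁ × n₁ ≡ a₁ +ℕ e) → (∃ λ p → ∃ λ den → ε ≡ + suc p / suc den) →
  ∃ λ m₀ → ∀ m → 0 < m → m₀ ≤ m → FailureBound (suc n₁) L R a ε m
bounded-for-parameters _ L R _ _ L⊆ R⊆ (a₁ , e , refl , refl) (p , den , refl) = eventually-bounded a₁ e den p L R L⊆ R⊆

corollaryB3 : (n : ℕ) → 0 < n → (L R : NSet) → L ⊆[ 0 , n ∸ 1 ] → R ⊆[ n , 2 *ℕ n ∸ 1 ] →
    (a : ℕ) → IsSmallestA n L R a →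
    (ε : ℚ) → 0ℚ <ℚ ε →
    ∃ λ m₀ → ∀ (m : ℕ) → 0 < m → m₀ ≤ m →
      prob m (λ v → ¬? (interval? (2 *ℕ n +ℕ 1 ∸ a) (2 *ℕ n +ℕ 2 *ℕ m +ℕ a ∸ 3) (Sset n m L R v) (Sset n m L R v)))
        ≤ℚ ((+ (a ∸ 2) / 1) * (half^ (τR n R a) + half^ (τL n L a))
            + (+ 6 / 1) * (half^ (count n L) + half^ (count (2 *ℕ n) R))
            + ε)
corollaryB3 (suc n₁) _ L R L⊆ R⊆ a smallest ε 0<ε =
  bounded-for-parameters n₁ L R a ε L⊆ R⊆ (smallest-a n₁ L R a L⊆ smallest) (positive-fraction ε 0<ε)
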